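{- Let $k\ge l\ge 0$ be integers with $k\ne0$, $m:=\gcd(k,l)$, $k_1:=k/m$, $l_1:=l/m$, $z=k+li$, and let $\square$ be the square in $\mathbb{C}$ with vertices $0,z,(1+i)z,iz$. A side of $\square$ passes through the barycenter (center) of some small square of the square lattice $\mathbb{Z}[i]$ if and only if $k_1\not\equiv0\pmod 2$ and $k_1\equiv l_1\pmod 2$. Moreover, in this case each side of $\square$ passes through exactly $m$ such barycenters.
   Context: The small squares of $\mathbb{Z}[i]$ are the squares with vertices $a+bi,\ (a+1)+bi,\ (a+1)+(b+1)i,\ a+(b+1)i$ for $a,b\in\mathbb{Z}$, with barycenter $a+\tfrac12+(b+\tfrac12)i$. -}

module Defs where

open import Data.Nat as ℕ using (ℕ)
open import Data.Nat.GCD using (gcd; gcd[m,n]≢0)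
open import Data.Nat.DivMod using (_/_)
open import Data.Integer as ℤ using (ℤ)
open import Data.Rational as ℚ using (ℚ; ½; 0ℚ; 1ℚ)
open import Data.Fin using (Fin; zero; suc)
open import Data.Product using (_×_; _,_; ∃; ∃-syntax; proj₁; proj₂)
open import Data.Sum using (inj₁)
open import Relation.Binary.PropositionalEquality using (_≡_; _≢_)

-- embedding ℤ → ℚ is  a ℚ./ 1
-- Complex numbers with rational coordinates: (real part , imaginary part)
ℂℚ : Set
ℂℚ = ℚ × ℚ

_+ᶜ_ : ℂℚ → ℂℚ → ℂℚ
(a , b) +ᶜ (c , d) = (a ℚ.+ c , b ℚ.+ d)

_-ᶜ_ : ℂℚ → ℂℚ → ℂℚ
(a , b) -ᶜ (c , d) = (a ℚ.- c , b ℚ.- d)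

_*ᶜ_ : ℂℚ → ℂℚ → ℂℚ
(a , b) *ᶜ (c , d) = (a ℚ.* c ℚ.- b ℚ.* d , a ℚ.* d ℚ.+ b ℚ.* c)

_·ᶜ_ : ℚ → ℂℚ → ℂℚ
t ·ᶜ (a , b) = (t ℚ.* a , t ℚ.* b)

iᶜ : ℂℚ
iᶜ = (0ℚ , 1ℚ)

oneᶜ : ℂℚ
oneᶜ = (1ℚ , 0ℚ)

zeroᶜ : ℂℚ
zeroᶜ = (0ℚ , 0ℚ)

zOf : ℕ → ℕ → ℂℚ
zOf k l = ((ℤ.+ k) ℚ./ 1 , (ℤ.+ l) ℚ./ 1)

vertex : ℂℚ → Fin 4 → ℂℚ
vertex z zero = zeroᶜ
vertex z (suc zero) = z
vertex z (suc (suc zero)) = (oneᶜ +ᶜ iᶜ) *ᶜ z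
vertex z (suc (suc (suc zero))) = iᶜ *ᶜ z

next : Fin 4 → Fin 4
next zero = suc zero
next (suc zero) = suc (suc zero)
next (suc (suc zero)) = suc (suc (suc zero))
next (suc (suc (suc zero))) = zero

OnSegment : ℂℚ → ℂℚ → ℂℚ → Set
OnSegment u v p = ∃[ t ] (0ℚ ℚ.≤ t × t ℚ.≤ 1ℚ × p ≡ u +ᶜ (t ·ᶜ (v -ᶜ u)))

-- barycenter of the small square with lower-left vertex a + b i
barycenter : ℤ → ℤ → ℂℚ
barycenter a b = ((a ℚ./ 1) ℚ.+ ½ , (b ℚ./ 1) ℚ.+ ½)

OnSide : ℂℚ → Fin 4 → ℂℚ → Set
OnSide z j p = OnSegment (vertex z j) (vertex z (next j)) p

divGcd : (k l : ℕ) → k ≢ 0 → ℕ → ℕ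
divGcd k l k≢0 n = _/_ n (gcd k l) {{ℕ.≢-nonZero (gcd[m,n]≢0 k l (inj₁ k≢0))}}

module Submission where

-- The quarter turn w ↦ z + i w about the centre of the square permutes its vertices cyclically
-- and maps barycenters of small squares to barycenters, so every side carries as many
-- barycenters as the base side [0, z]. The point (a + ½) + (b + ½) i lies on [0, z] iff
-- (2a + 1) l = (2b + 1) k and 0 ≤ 2a + 1 ≤ 2k. Dividing by m = gcd(k, l) and using that k₁ and
-- l₁ are coprime, this says 2a + 1 = (2i + 1) k₁ and 2b + 1 = (2i + 1) l₁ for some 0 ≤ i < m.
-- Such i exist iff k₁ and l₁ are both odd, and then there is exactly one barycenter for each i.

open import Defs
open import Data.Nat using (ℕ; _≤_; _%_)
open import Data.Nat.GCD using (gcd)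
open import Data.Integer using (ℤ)
open import Data.Fin using (Fin)
open import Data.Product using (_×_; _,_; ∃; ∃-syntax)
open import Data.List using (List; length)
open import Data.List.Membership.Propositional using (_∈_)
open import Data.List.Relation.Unary.Unique.Propositional using (Unique)
open import Relation.Binary.PropositionalEquality using (_≡_; _≢_)
open import Function.Bundles using (_⇔_)

open import Data.Nat as ℕ using (_+_; _*_; _<_; _/_; z≤n; s≤s)
import Data.Nat.Properties as ℕP
open import Data.Nat.DivMod using (m≡m%n+[m/n]*n; m%n<n; [m+kn]%n≡m%n; m/n*n≡m)
open import Data.Nat.Divisibility using (_∣_; divides; m%n≡0⇒n∣m; n∣m⇒m%n≡0; ∣m⇒∣m*n)
open import Data.Nat.GCD using (gcd[m,n]≢0; gcd[m,n]∣m; gcd[m,n]∣n)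
open import Data.Nat.Coprimality using (Coprime; coprime-divisor; coprime-/gcd)
import Data.Nat.Tactic.RingSolver as ℕ-Solver
open import Data.Integer as ℤ using (+_; -[1+_])
import Data.Integer.Properties as ℤP
import Data.Integer.Tactic.RingSolver as ℤ-Solver
open import Data.Rational as ℚ using (ℚ; ½; 0ℚ; 1ℚ)
import Data.Rational.Properties as ℚP
open import Data.Rational.Solver using (module +-*-Solver)
open import Data.Rational.Unnormalised as ℚᵘ using (mkℚᵘ; *≡*; *≤*)
import Data.Rational.Unnormalised.Properties as ℚᵘP
open import Data.Fin using (zero; suc)
open import Data.Product using (uncurry; proj₁; proj₂)
open import Data.Sum using (inj₁)
open import Data.Empty using (⊥-elim)
open import Relation.Nullary using (¬_)
open import Data.List using (map; upTo)
open import Data.List.Properties using (length-map; length-upTo)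
open import Data.List.Membership.Propositional.Properties using (∈-map⁺; ∈-map⁻; ∈-upTo⁺; ∈-upTo⁻)
import Data.List.Relation.Unary.Unique.Propositional.Properties as Unique
open import Function using (_∘_; case_of_)
open import Function.Bundles using (Equivalence; mk⇔)
open import Relation.Binary.PropositionalEquality using (refl; sym; trans; cong; cong₂; subst; subst₂; module ≡-Reasoning)

open +-*-Solver

ι : ℤ → ℚ
ι i = i ℚ./ 1

toℚᵘ-ι : ∀ i → ℚ.toℚᵘ (ι i) ℚᵘ.≃ mkℚᵘ i 0
toℚᵘ-ι i = ℚP.toℚᵘ-fromℚᵘ (mkℚᵘ i 0)

ι-injective : ∀ {i j} → ι i ≡ ι j → i ≡ j
ι-injective {i} {j} eq
  with ℚᵘP.≃-trans (ℚᵘP.≃-sym (toℚᵘ-ι i)) (ℚᵘP.≃-trans (ℚP.toℚᵘ-cong eq) (toℚᵘ-ι j))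
... | *≡* i*1≡j*1 = trans (sym (ℤP.*-identityʳ i)) (trans i*1≡j*1 (ℤP.*-identityʳ j))

ι-homo-+ : ∀ i j → ι (i ℤ.+ j) ≡ ι i ℚ.+ ι j
ι-homo-+ i j = ℚP.toℚᵘ-injective (ℚᵘP.≃-trans (toℚᵘ-ι (i ℤ.+ j)) (ℚᵘP.≃-sym (ℚᵘP.≃-trans
  (ℚP.toℚᵘ-homo-+ (ι i) (ι j)) (ℚᵘP.≃-trans (ℚᵘP.+-cong (toℚᵘ-ι i) (toℚᵘ-ι j)) (*≡* (cross i j))))))
  where
  cross : ∀ i j → (i ℤ.* + 1 ℤ.+ j ℤ.* + 1) ℤ.* + 1 ≡ (i ℤ.+ j) ℤ.* + 1
  cross = ℤ-Solver.solve-∀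

ι-homo-* : ∀ i j → ι (i ℤ.* j) ≡ ι i ℚ.* ι j
ι-homo-* i j = ℚP.toℚᵘ-injective (ℚᵘP.≃-trans (toℚᵘ-ι (i ℤ.* j)) (ℚᵘP.≃-sym (ℚᵘP.≃-trans
  (ℚP.toℚᵘ-homo-* (ι i) (ι j)) (ℚᵘP.≃-trans (ℚᵘP.*-cong (toℚᵘ-ι i) (toℚᵘ-ι j)) (*≡* refl)))))

ι-homo‿- : ∀ i → ι (ℤ.- i) ≡ ℚ.- ι i
ι-homo‿- i = ℚP.toℚᵘ-injective (ℚᵘP.≃-trans (toℚᵘ-ι (ℤ.- i)) (ℚᵘP.≃-sym (ℚᵘP.≃-trans
  (ℚP.toℚᵘ-homo‿- (ι i)) (ℚᵘP.-‿cong (toℚᵘ-ι i)))))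

ι-homo-- : ∀ i j → ι (i ℤ.- j) ≡ ι i ℚ.- ι j
ι-homo-- i j = trans (ι-homo-+ i (ℤ.- j)) (cong (ι i ℚ.+_) (ι-homo‿- j))

ι-cancel-≤ : ∀ {i j} → ι i ℚ.≤ ι j → i ℤ.≤ j
ι-cancel-≤ {i} {j} i≤j
  with ℚᵘP.≤-respʳ-≃ (toℚᵘ-ι j) (ℚᵘP.≤-respˡ-≃ (toℚᵘ-ι i) (ℚP.toℚᵘ-mono-≤ i≤j))
... | *≤* i*1≤j*1 = subst₂ ℤ._≤_ (ℤP.*-identityʳ i) (ℤP.*-identityʳ j) i*1≤j*1

ι-mono-≤ : ∀ {i j} → i ℤ.≤ j → ι i ℚ.≤ ι j
ι-mono-≤ {i} {j} i≤j = ℚP.toℚᵘ-cancel-≤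
  (ℚᵘP.≤-respʳ-≃ (ℚᵘP.≃-sym (toℚᵘ-ι j)) (ℚᵘP.≤-respˡ-≃ (ℚᵘP.≃-sym (toℚᵘ-ι i))
  (*≤* (subst₂ ℤ._≤_ (sym (ℤP.*-identityʳ i)) (sym (ℤP.*-identityʳ j)) i≤j))))

-- ι (+ 1) and ι (+ 2) compute to ½ + ½ and 1ℚ + 1ℚ, which turns the last step into a ring identity.
ι-odd : ∀ a → ι (+ 1 ℤ.+ a ℤ.* + 2) ≡ (ι a ℚ.+ ½) ℚ.+ (ι a ℚ.+ ½)
ι-odd a = begin
  ι (+ 1 ℤ.+ a ℤ.* + 2)                 ≡⟨ ι-homo-+ (+ 1) (a ℤ.* + 2) ⟩
  ι (+ 1) ℚ.+ ι (a ℤ.* + 2)             ≡⟨ cong (ι (+ 1) ℚ.+_) (ι-homo-* a (+ 2)) ⟩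
  (½ ℚ.+ ½) ℚ.+ ι a ℚ.* (1ℚ ℚ.+ 1ℚ)    ≡⟨ solve 2 (λ h x → (h :+ h) :+ x :* (con 1ℚ :+ con 1ℚ)
                                                       := (x :+ h) :+ (x :+ h)) refl ½ (ι a) ⟩
  (ι a ℚ.+ ½) ℚ.+ (ι a ℚ.+ ½)           ∎
  where open ≡-Reasoning

ι-odd⁺ : ∀ n → ι (+ (1 + n * 2)) ≡ (ι (+ n) ℚ.+ ½) ℚ.+ (ι (+ n) ℚ.+ ½)
ι-odd⁺ n = trans (cong ι (trans (ℤP.pos-+ 1 (n * 2)) (cong (ℤ._+_ (+ 1)) (ℤP.pos-* n 2)))) (ι-odd (+ n))

ι-double⁺ : ∀ n → ι (+ (n * 2)) ≡ ι (+ n) ℚ.+ ι (+ n)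
ι-double⁺ n = trans (cong ι (ℤP.pos-* n 2)) (trans (ι-homo-* (+ n) (+ 2))
  (solve 1 (λ x → x :* (con 1ℚ :+ con 1ℚ) := x :+ x) refl (ι (+ n))))

ι-odd-* : ∀ n m → ι (+ ((1 + n * 2) * m)) ≡ (ι (+ n) ℚ.+ ½) ℚ.* ι (+ m) ℚ.+ (ι (+ n) ℚ.+ ½) ℚ.* ι (+ m)
ι-odd-* n m = begin
  ι (+ ((1 + n * 2) * m))                   ≡⟨ cong ι (ℤP.pos-* (1 + n * 2) m) ⟩
  ι (+ (1 + n * 2) ℤ.* + m)                 ≡⟨ ι-homo-* (+ (1 + n * 2)) (+ m) ⟩
  ι (+ (1 + n * 2)) ℚ.* ι (+ m)             ≡⟨ cong (ℚ._* ι (+ m)) (ι-odd⁺ n) ⟩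
  (X ℚ.+ X) ℚ.* ι (+ m)                     ≡⟨ ℚP.*-distribʳ-+ (ι (+ m)) X X ⟩
  X ℚ.* ι (+ m) ℚ.+ X ℚ.* ι (+ m)           ∎
  where
  open ≡-Reasoning
  X = ι (+ n) ℚ.+ ½

odd-nonNeg : ∀ a → 0ℚ ℚ.≤ ι a ℚ.+ ½ → + 0 ℤ.≤ + 1 ℤ.+ a ℤ.* + 2
odd-nonNeg a 0≤X = ι-cancel-≤ (begin
  0ℚ                               ≡⟨ ℚP.+-identityʳ 0ℚ ⟨
  0ℚ ℚ.+ 0ℚ                        ≤⟨ ℚP.+-mono-≤ 0≤X 0≤X ⟩
  (ι a ℚ.+ ½) ℚ.+ (ι a ℚ.+ ½)      ≡⟨ ι-odd a ⟨
  ι (+ 1 ℤ.+ a ℤ.* + 2)            ∎)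
  where open ℚP.≤-Reasoning

nonNeg-half-integer : ∀ a → 0ℚ ℚ.≤ ι a ℚ.+ ½ → ∃[ n ] a ≡ + n
nonNeg-half-integer (+ n) _ = n , refl
nonNeg-half-integer -[1+ n ] 0≤X = ⊥-elim (negative (odd-nonNeg -[1+ n ] 0≤X))
  where
  negative : ¬ (+ 0 ℤ.≤ + 1 ℤ.+ -[1+ n ] ℤ.* + 2)
  negative ()

double-cancel-≤ : ∀ {x y} → x ℚ.+ x ℚ.≤ y ℚ.+ y → x ℚ.≤ y
double-cancel-≤ 2x≤2y = ℚP.≮⇒≥ (λ y<x → ℚP.<-irrefl refl (ℚP.<-≤-trans (ℚP.+-mono-< y<x y<x) 2x≤2y))

double-injective : ∀ {x y} → x ℚ.+ x ≡ y ℚ.+ y → x ≡ y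
double-injective eq = ℚP.≤-antisym (double-cancel-≤ (ℚP.≤-reflexive eq)) (double-cancel-≤ (ℚP.≤-reflexive (sym eq)))

affine : ℂℚ → ℂℚ → ℂℚ → ℂℚ
affine c ω w = c +ᶜ (ω *ᶜ w)

affine-interpolate : ∀ c ω u v t →
  affine c ω (u +ᶜ (t ·ᶜ (v -ᶜ u))) ≡ affine c ω u +ᶜ (t ·ᶜ (affine c ω v -ᶜ affine c ω u))
affine-interpolate (c , c') (ω , ω') (u , u') (v , v') t = cong₂ _,_
  (solve 9 (λ c c' ω ω' u u' v v' t →
      c :+ (ω :* (u :+ t :* (v :- u)) :- ω' :* (u' :+ t :* (v' :- u')))
   := (c :+ (ω :* u :- ω' :* u')) :+ t :* ((c :+ (ω :* v :- ω' :* v')) :- (c :+ (ω :* u :- ω' :* u'))))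
   refl c c' ω ω' u u' v v' t)
  (solve 9 (λ c c' ω ω' u u' v v' t →
      c' :+ (ω :* (u' :+ t :* (v' :- u')) :+ ω' :* (u :+ t :* (v :- u)))
   := (c' :+ (ω :* u' :+ ω' :* u)) :+ t :* ((c' :+ (ω :* v' :+ ω' :* v)) :- (c' :+ (ω :* u' :+ ω' :* u))))
   refl c c' ω ω' u u' v v' t)

OnSegment-affine : ∀ c ω {u v p} → OnSegment u v p → OnSegment (affine c ω u) (affine c ω v) (affine c ω p)
OnSegment-affine c ω {u} {v} (t , 0≤t , t≤1 , refl) = t , 0≤t , t≤1 , affine-interpolate c ω u v t

origin-interpolate : ∀ t w → 0ℚ ℚ.+ t ℚ.* (w ℚ.- 0ℚ) ≡ t ℚ.* w
origin-interpolate = solve 2 (λ t w → con 0ℚ :+ t :* (w :- con 0ℚ) := t :* w) refl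

module _ {K L X Y : ℚ} .{{_ : ℚ.Positive K}} where

  OnSegment-origin⇒ : OnSegment zeroᶜ (K , L) (X , Y) → X ℚ.* L ≡ Y ℚ.* K × 0ℚ ℚ.≤ X × X ℚ.≤ K
  OnSegment-origin⇒ (t , 0≤t , t≤1 , refl) = cross , lower , upper
    where
    open ℚP.≤-Reasoning
    cross : (0ℚ ℚ.+ t ℚ.* (K ℚ.- 0ℚ)) ℚ.* L ≡ (0ℚ ℚ.+ t ℚ.* (L ℚ.- 0ℚ)) ℚ.* K
    cross = solve 3 (λ t K L → (con 0ℚ :+ t :* (K :- con 0ℚ)) :* L := (con 0ℚ :+ t :* (L :- con 0ℚ)) :* K) refl t K L
    lower : 0ℚ ℚ.≤ 0ℚ ℚ.+ t ℚ.* (K ℚ.- 0ℚ)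
    lower = begin
      0ℚ                          ≡⟨ ℚP.*-zeroˡ K ⟨
      0ℚ ℚ.* K                    ≤⟨ ℚP.*-monoʳ-≤-nonNeg K {{ℚP.pos⇒nonNeg K}} 0≤t ⟩
      t ℚ.* K                     ≡⟨ origin-interpolate t K ⟨
      0ℚ ℚ.+ t ℚ.* (K ℚ.- 0ℚ)     ∎
    upper : 0ℚ ℚ.+ t ℚ.* (K ℚ.- 0ℚ) ℚ.≤ K
    upper = begin
      0ℚ ℚ.+ t ℚ.* (K ℚ.- 0ℚ)     ≡⟨ origin-interpolate t K ⟩
      t ℚ.* K                     ≤⟨ ℚP.*-monoʳ-≤-nonNeg K {{ℚP.pos⇒nonNeg K}} t≤1 ⟩
      1ℚ ℚ.* K                    ≡⟨ ℚP.*-identityˡ K ⟩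
      K                           ∎

  OnSegment-origin⇐ : X ℚ.* L ≡ Y ℚ.* K → 0ℚ ℚ.≤ X → X ℚ.≤ K → OnSegment zeroᶜ (K , L) (X , Y)
  OnSegment-origin⇐ XL≡YK 0≤X X≤K =
    t , 0≤t , t≤1 , cong₂ _,_ (sym (trans (origin-interpolate t K) tK≡X)) (sym (trans (origin-interpolate t L) tL≡Y))
    where
    instance _ = ℚP.pos⇒nonZero K
    t = X ℚ.* ℚ.1/ K
    tK≡X : t ℚ.* K ≡ X
    tK≡X = begin
      X ℚ.* ℚ.1/ K ℚ.* K    ≡⟨ ℚP.*-assoc X (ℚ.1/ K) K ⟩
      X ℚ.* (ℚ.1/ K ℚ.* K)  ≡⟨ cong (X ℚ.*_) (ℚP.*-inverseˡ K) ⟩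
      X ℚ.* 1ℚ              ≡⟨ ℚP.*-identityʳ X ⟩
      X                     ∎
      where open ≡-Reasoning
    tL≡Y : t ℚ.* L ≡ Y
    tL≡Y = begin
      X ℚ.* ℚ.1/ K ℚ.* L    ≡⟨ solve 3 (λ X r L → X :* r :* L := X :* L :* r) refl X (ℚ.1/ K) L ⟩
      X ℚ.* L ℚ.* ℚ.1/ K    ≡⟨ cong (ℚ._* ℚ.1/ K) XL≡YK ⟩
      Y ℚ.* K ℚ.* ℚ.1/ K    ≡⟨ ℚP.*-assoc Y K (ℚ.1/ K) ⟩
      Y ℚ.* (K ℚ.* ℚ.1/ K)  ≡⟨ cong (Y ℚ.*_) (ℚP.*-inverseʳ K) ⟩
      Y ℚ.* 1ℚ              ≡⟨ ℚP.*-identityʳ Y ⟩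
      Y                     ∎
      where open ≡-Reasoning
    0≤t : 0ℚ ℚ.≤ t
    0≤t = ℚP.*-cancelʳ-≤-pos K (begin
      0ℚ ℚ.* K  ≡⟨ ℚP.*-zeroˡ K ⟩
      0ℚ        ≤⟨ 0≤X ⟩
      X         ≡⟨ tK≡X ⟨
      t ℚ.* K   ∎)
      where open ℚP.≤-Reasoning
    t≤1 : t ℚ.≤ 1ℚ
    t≤1 = ℚP.*-cancelʳ-≤-pos K (begin
      t ℚ.* K   ≡⟨ tK≡X ⟩
      X         ≤⟨ X≤K ⟩
      K         ≡⟨ ℚP.*-identityˡ K ⟨
      1ℚ ℚ.* K  ∎)
      where open ℚP.≤-Reasoning

quarterTurn : ℂℚ → ℂℚ → ℂℚ
quarterTurn z = affine z iᶜ

quarterTurn-vertex : ∀ z j → quarterTurn z (vertex z j) ≡ vertex z (next j)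
quarterTurn-vertex (x , y) zero = cong₂ _,_
  (solve 1 (λ x → x :+ (con 0ℚ :* con 0ℚ :- con 1ℚ :* con 0ℚ) := x) refl x)
  (solve 1 (λ y → y :+ (con 0ℚ :* con 0ℚ :+ con 1ℚ :* con 0ℚ) := y) refl y)
quarterTurn-vertex (x , y) (suc zero) = cong₂ _,_
  (solve 2 (λ x y → x :+ (con 0ℚ :* x :- con 1ℚ :* y)
                    := (con 1ℚ :+ con 0ℚ) :* x :- (con 0ℚ :+ con 1ℚ) :* y) refl x y)
  (solve 2 (λ x y → y :+ (con 0ℚ :* y :+ con 1ℚ :* x)
                    := (con 1ℚ :+ con 0ℚ) :* y :+ (con 0ℚ :+ con 1ℚ) :* x) refl x y)
quarterTurn-vertex (x , y) (suc (suc zero)) = cong₂ _,_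
  (solve 2 (λ x y → x :+ (con 0ℚ :* ((con 1ℚ :+ con 0ℚ) :* x :- (con 0ℚ :+ con 1ℚ) :* y)
                          :- con 1ℚ :* ((con 1ℚ :+ con 0ℚ) :* y :+ (con 0ℚ :+ con 1ℚ) :* x))
                    := con 0ℚ :* x :- con 1ℚ :* y) refl x y)
  (solve 2 (λ x y → y :+ (con 0ℚ :* ((con 1ℚ :+ con 0ℚ) :* y :+ (con 0ℚ :+ con 1ℚ) :* x)
                          :+ con 1ℚ :* ((con 1ℚ :+ con 0ℚ) :* x :- (con 0ℚ :+ con 1ℚ) :* y))
                    := con 0ℚ :* y :+ con 1ℚ :* x) refl x y)
quarterTurn-vertex (x , y) (suc (suc (suc zero))) = cong₂ _,_
  (solve 2 (λ x y → x :+ (con 0ℚ :* (con 0ℚ :* x :- con 1ℚ :* y) :- con 1ℚ :* (con 0ℚ :* y :+ con 1ℚ :* x))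
                    := con 0ℚ) refl x y)
  (solve 2 (λ x y → y :+ (con 0ℚ :* (con 0ℚ :* y :+ con 1ℚ :* x) :+ con 1ℚ :* (con 0ℚ :* x :- con 1ℚ :* y))
                    := con 0ℚ) refl x y)

OnSide-quarterTurn : ∀ z j {p} → OnSide z j p → OnSide z (next j) (quarterTurn z p)
OnSide-quarterTurn z j on = subst₂ (λ u v → OnSegment u v _) (quarterTurn-vertex z j) (quarterTurn-vertex z (next j))
  (OnSegment-affine z iᶜ {vertex z j} {vertex z (next j)} on)

rotate : ℕ → ℕ → ℤ × ℤ → ℤ × ℤ
rotate k l (a , b) = (+ k ℤ.- b ℤ.- + 1 , + l ℤ.+ a)

quarterTurn-barycenter : ∀ k l p → quarterTurn (zOf k l) (uncurry barycenter p) ≡ uncurry barycenter (rotate k l p)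
quarterTurn-barycenter k l (a , b) = cong₂ _,_
  (begin
    K ℚ.+ (0ℚ ℚ.* (ι a ℚ.+ ½) ℚ.- 1ℚ ℚ.* (ι b ℚ.+ ½))
      ≡⟨ solve 4 (λ K A B h → K :+ (con 0ℚ :* (A :+ h) :- con 1ℚ :* (B :+ h)) := K :- B :- (h :+ h) :+ h)
                 refl K (ι a) (ι b) ½ ⟩
    K ℚ.- ι b ℚ.- ι (+ 1) ℚ.+ ½
      ≡⟨ cong (ℚ._+ ½) (trans (cong (ℚ._- ι (+ 1)) (sym (ι-homo-- (+ k) b))) (sym (ι-homo-- (+ k ℤ.- b) (+ 1)))) ⟩
    ι (+ k ℤ.- b ℤ.- + 1) ℚ.+ ½ ∎)
  (begin
    L ℚ.+ (0ℚ ℚ.* (ι b ℚ.+ ½) ℚ.+ 1ℚ ℚ.* (ι a ℚ.+ ½))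
      ≡⟨ solve 4 (λ L A B h → L :+ (con 0ℚ :* (B :+ h) :+ con 1ℚ :* (A :+ h)) := L :+ A :+ h) refl L (ι a) (ι b) ½ ⟩
    L ℚ.+ ι a ℚ.+ ½
      ≡⟨ cong (ℚ._+ ½) (sym (ι-homo-+ (+ l) a)) ⟩
    ι (+ l ℤ.+ a) ℚ.+ ½ ∎)
  where
  open ≡-Reasoning
  K = ι (+ k)
  L = ι (+ l)

rotate⁴ : ∀ k l p → rotate k l (rotate k l (rotate k l (rotate k l p))) ≡ p
rotate⁴ k l (a , b) = cong₂ _,_ (first a (+ k) (+ l)) (second b (+ k) (+ l))
  where
  first : ∀ a K L → K ℤ.- (L ℤ.+ (K ℤ.- (L ℤ.+ a) ℤ.- + 1)) ℤ.- + 1 ≡ a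
  first = ℤ-Solver.solve-∀
  second : ∀ b K L → L ℤ.+ (K ℤ.- (L ℤ.+ (K ℤ.- b ℤ.- + 1)) ℤ.- + 1) ≡ b
  second = ℤ-Solver.solve-∀

rotate-injective : ∀ k l {p q} → rotate k l p ≡ rotate k l q → p ≡ q
rotate-injective k l {p} {q} eq =
  trans (sym (rotate⁴ k l p)) (trans (cong (rotate k l ∘ rotate k l ∘ rotate k l) eq) (rotate⁴ k l q))

next⁴ : ∀ j → next (next (next (next j))) ≡ j
next⁴ zero = refl
next⁴ (suc zero) = refl
next⁴ (suc (suc zero)) = refl
next⁴ (suc (suc (suc zero))) = refl

OnSide-rotate : ∀ k l j p → OnSide (zOf k l) j (uncurry barycenter p) →
  OnSide (zOf k l) (next j) (uncurry barycenter (rotate k l p))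
OnSide-rotate k l j p on =
  subst (OnSide (zOf k l) (next j)) (quarterTurn-barycenter k l p) (OnSide-quarterTurn (zOf k l) j on)

OnSide-rotate³ : ∀ k l j p → OnSide (zOf k l) (next j) (uncurry barycenter p) →
  OnSide (zOf k l) j (uncurry barycenter (rotate k l (rotate k l (rotate k l p))))
OnSide-rotate³ k l j p on = subst (λ j' → OnSide (zOf k l) j' (uncurry barycenter (ρ (ρ (ρ p))))) (next⁴ j)
  (OnSide-rotate k l (next (next (next j))) (ρ (ρ p))
    (OnSide-rotate k l (next (next j)) (ρ p) (OnSide-rotate k l (next j) p on)))
  where ρ = rotate k l

to-base-side : ∀ k l j p → OnSide (zOf k l) j (uncurry barycenter p) →
  ∃[ q ] OnSide (zOf k l) zero (uncurry barycenter q)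
to-base-side k l zero p on = p , on
to-base-side k l (suc zero) p on = ρ (ρ (ρ p)) , OnSide-rotate³ k l zero p on
  where ρ = rotate k l
to-base-side k l (suc (suc zero)) p on =
  ρ (ρ p) , OnSide-rotate k l (suc (suc (suc zero))) (ρ p) (OnSide-rotate k l (suc (suc zero)) p on)
  where ρ = rotate k l
to-base-side k l (suc (suc (suc zero))) p on = rotate k l p , OnSide-rotate k l (suc (suc (suc zero))) p on

record Enumerates (k l : ℕ) (j : Fin 4) (bs : List (ℤ × ℤ)) : Set where
  constructor enumerates
  field
    unique  : Unique bs
    members : ∀ p → OnSide (zOf k l) j (uncurry barycenter p) ⇔ p ∈ bs

Enumerates-rotate : ∀ {k l j bs} → Enumerates k l j bs → Enumerates k l (next j) (map (rotate k l) bs)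
Enumerates-rotate {k} {l} {j} {bs} (enumerates unique members) =
  enumerates (Unique.map⁺ (rotate-injective k l) unique) λ p → mk⇔ (to p) (from p)
  where
  ρ = rotate k l
  to : ∀ p → OnSide (zOf k l) (next j) (uncurry barycenter p) → p ∈ map ρ bs
  to p on = subst (_∈ map ρ bs) (rotate⁴ k l p)
    (∈-map⁺ ρ (Equivalence.to (members (ρ (ρ (ρ p)))) (OnSide-rotate³ k l j p on)))
  from : ∀ p → p ∈ map ρ bs → OnSide (zOf k l) (next j) (uncurry barycenter p)
  from p p∈ with ∈-map⁻ ρ p∈
  ... | q , q∈bs , refl = OnSide-rotate k l j q (Equivalence.from (members q) q∈bs)

Enumerates-every-side : ∀ {k l bs} → Enumerates k l zero bs →
  ∀ j → ∃[ bs' ] (Enumerates k l j bs' × length bs' ≡ length bs)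
Enumerates-every-side {k} {l} {bs} base = every
  where
  step : ∀ {j} → ∃[ bs' ] (Enumerates k l j bs' × length bs' ≡ length bs) →
         ∃[ bs' ] (Enumerates k l (next j) bs' × length bs' ≡ length bs)
  step (bs' , enum , len) = map (rotate k l) bs' , Enumerates-rotate enum , trans (length-map (rotate k l) bs') len
  every : ∀ j → ∃[ bs' ] (Enumerates k l j bs' × length bs' ≡ length bs)
  every zero = bs , base , refl
  every (suc zero) = step (every zero)
  every (suc (suc zero)) = step (step (every zero))
  every (suc (suc (suc zero))) = step (step (step (every zero)))

odd-%2 : ∀ n → (1 + n * 2) % 2 ≡ 1
odd-%2 n = [m+kn]%n≡m%n 1 n 2

%2≢0⇒%2≡1 : ∀ m → m % 2 ≢ 0 → m % 2 ≡ 1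
%2≢0⇒%2≡1 m m%2≢0 = remainder (m % 2) (m%n<n m 2) m%2≢0
  where
  remainder : ∀ r → r < 2 → r ≢ 0 → r ≡ 1
  remainder 0 _ r≢0 = ⊥-elim (r≢0 refl)
  remainder 1 _ _ = refl
  remainder (ℕ.suc (ℕ.suc _)) (s≤s (s≤s ())) _

%2≢0⇒odd : ∀ m → m % 2 ≢ 0 → m ≡ 1 + m / 2 * 2
%2≢0⇒odd m m%2≢0 = trans (m≡m%n+[m/n]*n m 2) (cong (_+ m / 2 * 2) (%2≢0⇒%2≡1 m m%2≢0))

odd-factor : ∀ m n a → m * n ≡ 1 + a * 2 → m % 2 ≢ 0
odd-factor m n a mn≡odd m%2≡0 = 0≢1 (trans (sym (n∣m⇒m%n≡0 _ 2 2∣odd)) (odd-%2 a))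
  where
  0≢1 : 0 ≢ 1
  0≢1 ()
  2∣odd : 2 ∣ 1 + a * 2
  2∣odd = subst (2 ∣_) mn≡odd (∣m⇒∣m*n n (m%n≡0⇒n∣m m 2 m%2≡0))

odd-injective : ∀ {m n} → 1 + m * 2 ≡ 1 + n * 2 → m ≡ n
odd-injective {m} {n} eq = ℕP.*-cancelʳ-≡ m n 2 (ℕP.suc-injective eq)

odd-multiple⇔ : ∀ {k} i a → k % 2 ≢ 0 → (1 + a * 2 ≡ (1 + i * 2) * k) ⇔ (a ≡ i * k + k / 2)
odd-multiple⇔ {k} i a k%2≢0 =
  mk⇔ (λ eq → odd-injective (trans eq expand)) (λ eq → trans (cong (λ x → 1 + x * 2) eq) (sym expand))
  where
  open ≡-Reasoning
  p = k / 2
  k-odd = %2≢0⇒odd k k%2≢0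
  identity : ∀ i p → (1 + i * 2) * (1 + p * 2) ≡ 1 + (i * (1 + p * 2) + p) * 2
  identity = ℕ-Solver.solve-∀
  expand : (1 + i * 2) * k ≡ 1 + (i * k + p) * 2
  expand = begin
    (1 + i * 2) * k                ≡⟨ cong ((1 + i * 2) *_) k-odd ⟩
    (1 + i * 2) * (1 + p * 2)      ≡⟨ identity i p ⟩
    1 + (i * (1 + p * 2) + p) * 2  ≡⟨ cong (λ x → 1 + (i * x + p) * 2) k-odd ⟨
    1 + (i * k + p) * 2            ∎

-- (a + ½) + (b + ½) i lies on the segment [0, k + l i], with denominators cleared
CentreOnBaseSide : ℕ → ℕ → ℕ → ℕ → Set
CentreOnBaseSide k l a b = (1 + a * 2) * l ≡ (1 + b * 2) * k × 1 + a * 2 ≤ k * 2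

OddMultiples : ℕ → ℕ → ℕ → ℕ → ℕ → Set
OddMultiples k₁ l₁ g a b = ∃[ i ] (i < g × 1 + a * 2 ≡ (1 + i * 2) * k₁ × 1 + b * 2 ≡ (1 + i * 2) * l₁)

module _ {k l : ℕ} where
  private
    K = ι (+ k)
    L = ι (+ l)
    X : ℕ → ℚ
    X n = ι (+ n) ℚ.+ ½

  cross⇔ : ∀ a b → (1 + a * 2) * l ≡ (1 + b * 2) * k ⇔ X a ℚ.* L ≡ X b ℚ.* K
  cross⇔ a b = mk⇔
    (λ eq → double-injective (trans (sym (ι-odd-* a l)) (trans (cong (ι ∘ +_) eq) (ι-odd-* b k))))
    (λ eq → ℤP.+-injective (ι-injective (trans (ι-odd-* a l) (trans (cong₂ ℚ._+_ eq eq) (sym (ι-odd-* b k))))))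

  bound⇔ : ∀ a → 1 + a * 2 ≤ k * 2 ⇔ X a ℚ.≤ K
  bound⇔ a = mk⇔
    (λ le → double-cancel-≤ (begin
      X a ℚ.+ X a             ≡⟨ ι-odd⁺ a ⟨
      ι (+ (1 + a * 2))       ≤⟨ ι-mono-≤ (ℤ.+≤+ le) ⟩
      ι (+ (k * 2))           ≡⟨ ι-double⁺ k ⟩
      K ℚ.+ K                 ∎))
    (λ le → ℤP.drop‿+≤+ (ι-cancel-≤ (begin
      ι (+ (1 + a * 2))       ≡⟨ ι-odd⁺ a ⟩
      X a ℚ.+ X a             ≤⟨ ℚP.+-mono-≤ le le ⟩
      K ℚ.+ K                 ≡⟨ ι-double⁺ k ⟨
      ι (+ (k * 2))           ∎)))
    where open ℚP.≤-Reasoning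

  X-nonNeg : ∀ a → 0ℚ ℚ.≤ X a
  X-nonNeg a = double-cancel-≤ (begin
    0ℚ ℚ.+ 0ℚ               ≡⟨ ℚP.+-identityʳ 0ℚ ⟩
    0ℚ                      ≤⟨ ι-mono-≤ {+ 0} {+ (1 + a * 2)} (ℤ.+≤+ z≤n) ⟩
    ι (+ (1 + a * 2))       ≡⟨ ι-odd⁺ a ⟩
    X a ℚ.+ X a             ∎)
    where open ℚP.≤-Reasoning

  barycenter-on-base-side⇔ : ∀ a b → k ≢ 0 →
    OnSide (zOf k l) zero (barycenter a b) ⇔ (∃[ a' ] ∃[ b' ] (a ≡ + a' × b ≡ + b' × CentreOnBaseSide k l a' b'))
  barycenter-on-base-side⇔ a b k≢0 = mk⇔
    (λ on → to (OnSegment-origin⇒ on))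
    (λ { (a' , b' , refl , refl , cross , bound) →
           OnSegment-origin⇐ (Equivalence.to (cross⇔ a' b') cross) (X-nonNeg a') (Equivalence.to (bound⇔ a') bound) })
    where
    instance
      K>0 : ℚ.Positive K
      K>0 = ℚP.normalize-pos k 1 {{_}} {{ℕ.≢-nonZero k≢0}}
      L≥0 : ℚ.NonNegative L
      L≥0 = ℚP.normalize-nonNeg l 1
    nonNeg-by-cross : ∀ {x y} → x ℚ.* L ≡ y ℚ.* K → 0ℚ ℚ.≤ x → 0ℚ ℚ.≤ y
    nonNeg-by-cross {x} {y} xL≡yK 0≤x = ℚP.*-cancelʳ-≤-pos K (begin
      0ℚ ℚ.* K   ≡⟨ ℚP.*-zeroˡ K ⟩
      0ℚ         ≡⟨ ℚP.*-zeroˡ L ⟨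
      0ℚ ℚ.* L   ≤⟨ ℚP.*-monoʳ-≤-nonNeg L 0≤x ⟩
      x ℚ.* L    ≡⟨ xL≡yK ⟩
      y ℚ.* K    ∎)
      where open ℚP.≤-Reasoning
    to : (ι a ℚ.+ ½) ℚ.* L ≡ (ι b ℚ.+ ½) ℚ.* K × 0ℚ ℚ.≤ ι a ℚ.+ ½ × ι a ℚ.+ ½ ℚ.≤ K →
         ∃[ a' ] ∃[ b' ] (a ≡ + a' × b ≡ + b' × CentreOnBaseSide k l a' b')
    to (cross , 0≤Xa , Xa≤K) with nonNeg-half-integer a 0≤Xa | nonNeg-half-integer b (nonNeg-by-cross cross 0≤Xa)
    ... | a' , refl | b' , refl =
      a' , b' , refl , refl , Equivalence.from (cross⇔ a' b') cross , Equivalence.from (bound⇔ a') Xa≤K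

CentreOnBaseSide⇒OddMultiples : ∀ {k₁ l₁ g} a b → Coprime k₁ l₁ →
  CentreOnBaseSide (k₁ * g) (l₁ * g) a b → OddMultiples k₁ l₁ g a b
CentreOnBaseSide⇒OddMultiples {k₁} {l₁} {g} a b coprime (cross , bound) =
  i , i<g , trans A≡sk₁ (cong (_* k₁) s-odd) , trans B≡sl₁ (cong (_* l₁) s-odd)
  where
  instance
    k₁g2≢0 = ℕ.>-nonZero (ℕP.≤-trans (s≤s z≤n) bound)
    k₁g≢0 = ℕP.m*n≢0⇒m≢0 (k₁ * g)
    k₁≢0 = ℕP.m*n≢0⇒m≢0 k₁
    g≢0 = ℕP.m*n≢0⇒n≢0 k₁
  A = 1 + a * 2
  B = 1 + b * 2
  cross₁ : A * l₁ ≡ B * k₁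
  cross₁ = ℕP.*-cancelʳ-≡ _ _ g (trans (ℕP.*-assoc A l₁ g) (trans cross (sym (ℕP.*-assoc B k₁ g))))
  k₁∣A : k₁ ∣ A
  k₁∣A = coprime-divisor coprime (divides B (trans (ℕP.*-comm l₁ A) cross₁))
  s = _∣_.quotient k₁∣A
  A≡sk₁ : A ≡ s * k₁
  A≡sk₁ = _∣_.equality k₁∣A
  B≡sl₁ : B ≡ s * l₁
  B≡sl₁ = ℕP.*-cancelʳ-≡ _ _ k₁ (begin
    B * k₁        ≡⟨ cross₁ ⟨
    A * l₁        ≡⟨ cong (_* l₁) A≡sk₁ ⟩
    s * k₁ * l₁   ≡⟨ swap s k₁ l₁ ⟩
    s * l₁ * k₁   ∎)
    where
    open ≡-Reasoning
    swap : ∀ s k l → s * k * l ≡ s * l * k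
    swap = ℕ-Solver.solve-∀
  i = s / 2
  s-odd : s ≡ 1 + i * 2
  s-odd = %2≢0⇒odd s (odd-factor s k₁ a (sym A≡sk₁))
  i<g : i < g
  i<g = ℕP.*-cancelʳ-< 2 i g (ℕP.*-cancelʳ-≤ (1 + i * 2) (g * 2) k₁ (begin
    (1 + i * 2) * k₁  ≡⟨ cong (_* k₁) s-odd ⟨
    s * k₁            ≡⟨ A≡sk₁ ⟨
    A                 ≤⟨ bound ⟩
    k₁ * g * 2        ≡⟨ rearrange k₁ g ⟩
    g * 2 * k₁        ∎))
    where
    open ℕP.≤-Reasoning
    rearrange : ∀ k g → k * g * 2 ≡ g * 2 * k
    rearrange = ℕ-Solver.solve-∀

OddMultiples⇒CentreOnBaseSide : ∀ {k₁ l₁ g} a b →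
  OddMultiples k₁ l₁ g a b → CentreOnBaseSide (k₁ * g) (l₁ * g) a b
OddMultiples⇒CentreOnBaseSide {k₁} {l₁} {g} a b (i , i<g , A≡ , B≡) = cross , bound
  where
  cross : (1 + a * 2) * (l₁ * g) ≡ (1 + b * 2) * (k₁ * g)
  cross = begin
    (1 + a * 2) * (l₁ * g)         ≡⟨ cong (_* (l₁ * g)) A≡ ⟩
    (1 + i * 2) * k₁ * (l₁ * g)    ≡⟨ rearrange (1 + i * 2) k₁ l₁ g ⟩
    (1 + i * 2) * l₁ * (k₁ * g)    ≡⟨ cong (_* (k₁ * g)) B≡ ⟨
    (1 + b * 2) * (k₁ * g)         ∎
    where
    open ≡-Reasoning
    rearrange : ∀ s k l g → s * k * (l * g) ≡ s * l * (k * g)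
    rearrange = ℕ-Solver.solve-∀
  bound : 1 + a * 2 ≤ k₁ * g * 2
  bound = begin
    1 + a * 2         ≡⟨ A≡ ⟩
    (1 + i * 2) * k₁  ≤⟨ ℕP.*-monoˡ-≤ k₁ (ℕP.*-monoˡ-< 2 i<g) ⟩
    g * 2 * k₁        ≡⟨ rearrange g k₁ ⟩
    k₁ * g * 2        ∎
    where
    open ℕP.≤-Reasoning
    rearrange : ∀ g k → g * 2 * k ≡ k * g * 2
    rearrange = ℕ-Solver.solve-∀

centre-on-base-side⇔ : ∀ {k l k₁ l₁ g} a b → k ≡ k₁ * g → l ≡ l₁ * g → Coprime k₁ l₁ →
  CentreOnBaseSide k l a b ⇔ OddMultiples k₁ l₁ g a b
centre-on-base-side⇔ a b refl refl coprime =
  mk⇔ (CentreOnBaseSide⇒OddMultiples a b coprime) (OddMultiples⇒CentreOnBaseSide a b)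

module _ (k l : ℕ) (k≢0 : k ≢ 0) where
  private
    g = gcd k l
    k₁ = divGcd k l k≢0 k
    l₁ = divGcd k l k≢0 l
    instance
      g≢0 : ℕ.NonZero g
      g≢0 = ℕ.≢-nonZero (gcd[m,n]≢0 k l (inj₁ k≢0))
    base-side⇔ : ∀ a b → OnSide (zOf k l) zero (barycenter a b) ⇔
                 (∃[ a' ] ∃[ b' ] (a ≡ + a' × b ≡ + b' × OddMultiples k₁ l₁ g a' b'))
    base-side⇔ a b = mk⇔
      (λ on → case Equivalence.to (barycenter-on-base-side⇔ a b k≢0) on of λ
        { (a' , b' , a≡ , b≡ , centre) → a' , b' , a≡ , b≡ , Equivalence.to (centre⇔ a' b') centre })
      (λ { (a' , b' , a≡ , b≡ , multiples) → Equivalence.from (barycenter-on-base-side⇔ a b k≢0)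
             (a' , b' , a≡ , b≡ , Equivalence.from (centre⇔ a' b') multiples) })
      where
      centre⇔ : ∀ a' b' → CentreOnBaseSide k l a' b' ⇔ OddMultiples k₁ l₁ g a' b'
      centre⇔ a' b' = centre-on-base-side⇔ a' b' (sym (m/n*n≡m (gcd[m,n]∣m k l))) (sym (m/n*n≡m (gcd[m,n]∣n k l)))
                        (coprime-/gcd k l)

  odd-of-base-side : ∀ p → OnSide (zOf k l) zero (uncurry barycenter p) → k₁ % 2 ≢ 0 × l₁ % 2 ≢ 0
  odd-of-base-side (a , b) on = odd (Equivalence.to (base-side⇔ a b) on)
    where
    odd : (∃[ a' ] ∃[ b' ] (a ≡ + a' × b ≡ + b' × OddMultiples k₁ l₁ g a' b')) → k₁ % 2 ≢ 0 × l₁ % 2 ≢ 0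
    odd (a' , b' , _ , _ , i , _ , A≡ , B≡) =
        odd-factor k₁ (1 + i * 2) a' (trans (ℕP.*-comm k₁ _) (sym A≡))
      , odd-factor l₁ (1 + i * 2) b' (trans (ℕP.*-comm l₁ _) (sym B≡))

  barycenter-on-side⇒odd : ∀ j a b → OnSide (zOf k l) j (barycenter a b) → k₁ % 2 ≢ 0 × k₁ % 2 ≡ l₁ % 2
  barycenter-on-side⇒odd j a b on = k₁-odd , trans (%2≢0⇒%2≡1 k₁ k₁-odd) (sym (%2≢0⇒%2≡1 l₁ l₁-odd))
    where
    base = to-base-side k l j (a , b) on
    k₁-odd = proj₁ (odd-of-base-side (proj₁ base) (proj₂ base))
    l₁-odd = proj₂ (odd-of-base-side (proj₁ base) (proj₂ base))

  baseCentre : ℕ → ℤ × ℤ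
  baseCentre i = + (i * k₁ + k₁ / 2) , + (i * l₁ + l₁ / 2)

  module _ (k₁-odd : k₁ % 2 ≢ 0) (same-parity : k₁ % 2 ≡ l₁ % 2) where
    private
      l₁-odd : l₁ % 2 ≢ 0
      l₁-odd l₁%2≡0 = k₁-odd (trans same-parity l₁%2≡0)

    on-base-side⇔ : ∀ p → OnSide (zOf k l) zero (uncurry barycenter p) ⇔ (∃[ i ] (i < g × p ≡ baseCentre i))
    on-base-side⇔ (a , b) = mk⇔
      (λ on → case Equivalence.to (base-side⇔ a b) on of λ
        { (a' , b' , refl , refl , i , i<g , A≡ , B≡) → i , i<g ,
            cong₂ _,_ (cong +_ (Equivalence.to (odd-multiple⇔ i a' k₁-odd) A≡))
                      (cong +_ (Equivalence.to (odd-multiple⇔ i b' l₁-odd) B≡)) })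
      (λ { (i , i<g , refl) → Equivalence.from (base-side⇔ a b)
             (_ , _ , refl , refl , i , i<g , Equivalence.from (odd-multiple⇔ i _ k₁-odd) refl
                                            , Equivalence.from (odd-multiple⇔ i _ l₁-odd) refl) })

    baseCentre-injective : ∀ {i j} → baseCentre i ≡ baseCentre j → i ≡ j
    baseCentre-injective {i} {j} eq =
      ℕP.*-cancelʳ-≡ i j k₁ {{ℕ.≢-nonZero (λ k₁≡0 → k₁-odd (cong (_% 2) k₁≡0))}}
        (ℕP.+-cancelʳ-≡ (k₁ / 2) (i * k₁) (j * k₁) (ℤP.+-injective (cong proj₁ eq)))

    base-side-enumeration : Enumerates k l zero (map baseCentre (upTo g))
    base-side-enumeration = enumerates (Unique.map⁺ baseCentre-injective (Unique.upTo⁺ g)) λ p → mk⇔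
      (λ on → case Equivalence.to (on-base-side⇔ p) on of λ { (i , i<g , refl) → ∈-map⁺ baseCentre (∈-upTo⁺ i<g) })
      (λ p∈ → case ∈-map⁻ baseCentre p∈ of λ
        { (i , i∈ , p≡) → Equivalence.from (on-base-side⇔ p) (i , ∈-upTo⁻ i∈ , p≡) })

    first-barycenter-on-base-side : OnSide (zOf k l) zero (uncurry barycenter (baseCentre 0))
    first-barycenter-on-base-side = Equivalence.from (on-base-side⇔ (baseCentre 0)) (0 , ℕ.>-nonZero⁻¹ g , refl)

    every-side-enumerated : ∀ j → ∃[ bs ] (Enumerates k l j bs × length bs ≡ g)
    every-side-enumerated j = case Enumerates-every-side base-side-enumeration j of λ
      { (bs , enum , len) → bs , enum , trans len (trans (length-map baseCentre (upTo g)) (length-upTo g)) }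

lemma2p6 : (k l : ℕ) → l ≤ k → (k≢0 : k ≢ 0) →
    ((∃[ j ] ∃[ a ] ∃[ b ] OnSide (zOf k l) j (barycenter a b))
      ⇔ ((divGcd k l k≢0 k % 2 ≢ 0) × (divGcd k l k≢0 k % 2 ≡ divGcd k l k≢0 l % 2)))
    × ((divGcd k l k≢0 k % 2 ≢ 0) → (divGcd k l k≢0 k % 2 ≡ divGcd k l k≢0 l % 2) →
        (j : Fin 4) → ∃[ bs ] (Unique bs × length bs ≡ gcd k l
          × ((a b : ℤ) → OnSide (zOf k l) j (barycenter a b) ⇔ ((a , b) ∈ bs))))
lemma2p6 k l _ k≢0 =
    mk⇔ (λ { (j , a , b , on) → barycenter-on-side⇒odd k l k≢0 j a b on })
        (λ { (k₁-odd , same-parity) → zero , proj₁ (baseCentre k l k≢0 0) , proj₂ (baseCentre k l k≢0 0)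
                                         , first-barycenter-on-base-side k l k≢0 k₁-odd same-parity })
  , λ k₁-odd same-parity j → case every-side-enumerated k l k≢0 k₁-odd same-parity j of λ
      { (bs , enumerates unique members , len) → bs , unique , len , λ a b → members (a , b) }
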